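{- Suppose that $1/n\ll1/f,\alpha$. Let $G$ be a digraph of order $n$ with $\delta^0(G)\ge(\tfrac12+\alpha)n$. If $F\subseteq G$ and $\Delta^0(F)\le f$, then $G$ contains a spanning $d$-regular subdigraph $H$ such that (i) $H$ contains $F$, (ii) $d\le25n^{2/3}/\alpha$, and (iii) $H$ is an expander.
   Context: $1/n\ll 1/f,\alpha$ means: for all $f,\alpha$ the statement holds for all sufficiently large $n$. $\delta^0$ is the minimum over vertices of $\min\{\deg^+,\deg^-\}$ and $\Delta^0$ the maximum over vertices of $\max\{\deg^+,\deg^-\}$. A digraph is $d$-regular if every vertex has in- and outdegree exactly $d$. A digraph $D$ is an expander if $|N^-(S)|>|S|$ and $|N^+(S)|>|S|$ for every nonempty proper subset $S\subseteq V(D)$, where $N^\pm(S)=\bigcup_{x\in S}N^\pm(x)$.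
   Formalization: The parameter α ranges over the positive rationals. -}

module Defs where

open import Data.Nat using (ℕ; _+_; _*_; _^_; _≤_; _<_)
open import Data.Bool using (Bool; true; false; T; _∧_; if_then_else_)
open import Data.Fin using (Fin)
open import Data.Fin.Subset using (Subset; ∣_∣; Nonempty; ∁)
open import Data.List using (List; map; allFin)
open import Data.Nat.ListAction using (sum)
open import Data.Bool.ListAction using (any)
open import Data.Vec using (tabulate; lookup)
open import Data.Product using (_×_)
open import Relation.Binary.PropositionalEquality using (_≡_)

record Digraph (n : ℕ) : Set where
  field
    adj      : Fin n → Fin n → Bool
    loopless : ∀ x → adj x x ≡ false
open Digraph public

count : {n : ℕ} → (Fin n → Bool) → ℕ
count {n} P = sum (map (λ i → if P i then 1 else 0) (allFin n))

outdeg : {n : ℕ} → Digraph n → Fin n → ℕ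
outdeg G x = count (λ y → adj G x y)

indeg : {n : ℕ} → Digraph n → Fin n → ℕ
indeg G x = count (λ y → adj G y x)

_⊆ᴰ_ : {n : ℕ} → Digraph n → Digraph n → Set
F ⊆ᴰ G = ∀ x y → T (adj F x y) → T (adj G x y)

MinSemiDeg≥ : {n : ℕ} → Digraph n → ℕ → Set
MinSemiDeg≥ G m = ∀ x → (m ≤ outdeg G x) × (m ≤ indeg G x)

MaxSemiDeg≤ : {n : ℕ} → Digraph n → ℕ → Set
MaxSemiDeg≤ F f = ∀ x → (outdeg F x ≤ f) × (indeg F x ≤ f)

Regular : {n : ℕ} → Digraph n → ℕ → Set
Regular H d = ∀ x → (outdeg H x ≡ d) × (indeg H x ≡ d)

outNbhd : {n : ℕ} → Digraph n → Subset n → Subset n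
outNbhd {n} G S = tabulate (λ y → any (λ x → lookup S x ∧ adj G x y) (allFin n))

inNbhd : {n : ℕ} → Digraph n → Subset n → Subset n
inNbhd {n} G S = tabulate (λ y → any (λ x → lookup S x ∧ adj G y x) (allFin n))

Expander : {n : ℕ} → Digraph n → Set
Expander {n} D = (S : Subset n) → Nonempty S → Nonempty (∁ S) →
  (∣ S ∣ < ∣ inNbhd D S ∣) × (∣ S ∣ < ∣ outNbhd D S ∣)

{-# OPTIONS --safe #-}
module Submission where

-- H is a union of D pairwise arc-disjoint permutations σ of V(G), each with all its arcs x → σ x in G,
-- so H is D-regular, and D depends on f and α only; hence (ii) holds for large n.
--
-- Such a permutation can avoid the ≤ D arcs already used at each vertex and extend a prescribed partial
-- matching M whenever deg⁺ x + deg⁻ y > n + |dom M| in the remaining digraph, for all x, y; as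
-- δ⁰(G) ≥ (1/2 + α)n, this holds for |dom M| ≤ L ≈ n/q, where α = p/q. Start from any permutation
-- through M and repair each vertex u with u → σ u ∉ G by swapping images with a vertex w ∉ dom M such
-- that u → σ w and w → σ u are arcs; w exists by pigeonhole.
--
-- F is split into partial matchings, by the rank of y among the out-neighbours of x, the rank of x among
-- the in-neighbours of y, and the block of L consecutive vertices containing x; each gets a permutation.
--
-- Fix one permutation σ₀. Then N⁺(S) ⊇ σ₀(S) and N⁻(S) ⊇ σ₀⁻¹(S), with strict inclusions unless S or
-- the complement of σ₀⁻¹(S) is closed under all the maps σ₀⁻¹ ∘ σ. These maps are permutations, so the
-- complement of a closed set is closed, and H is an expander once every closed set containing a fixed
-- vertex v₀ is everything. This is forced by q further permutations σ₀ ∘ τ, as qL > n: each τ extends a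
-- partial matching, built greedily from the set reached from v₀ so far, that reaches L new vertices.

open import Defs
import Algebra.Properties.CommutativeMonoid.Sum as CommutativeMonoidSum
open import Data.Bool using (Bool; true; false; T; not; _∧_; _∨_; if_then_else_)
open import Data.Bool.ListAction using (any)
open import Data.Bool.Properties using (T-∧; T-∨; T-not-≡)
open import Data.Empty using (⊥; ⊥-elim)
open import Data.Fin using (Fin; zero; suc; toℕ; fromℕ<)
open import Data.Fin.Permutation using (Permutation′; _⟨$⟩ʳ_; _⟨$⟩ˡ_; inverseʳ; inverseˡ; transpose; _∘ₚ_)
import Data.Fin.Permutation as Permutation
open import Data.Fin.Properties using (_≟_; any?; toℕ-injective; toℕ<n)
open import Data.Fin.Subset using (Subset; ∣_∣)
import Data.Fin.Subset as Subset
open import Data.List using (List; []; _∷_; map; allFin; tabulate; length; cartesianProduct; upTo)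
open import Data.List.Membership.Propositional using (_∈_; lose; find)
open import Data.List.Membership.Propositional.Properties
  using (∈-allFin; ∈-map⁺; ∈-map⁻; ∈-cartesianProduct⁺; ∈-upTo⁺)
open import Data.List.Properties using (map-tabulate; length-map)
import Data.List.Relation.Unary.All as All
open import Data.List.Relation.Unary.AllPairs using (AllPairs; []; _∷_)
import Data.List.Relation.Unary.AllPairs as AllPairs
import Data.List.Relation.Unary.AllPairs.Properties as AllPairs
open import Data.List.Relation.Unary.Any using (here; there; satisfied)
import Data.List.Relation.Unary.Any as Any
open import Data.List.Relation.Unary.Any.Properties using (any⁺; any⁻)
open import Data.List.Relation.Unary.Unique.Propositional using (Unique)
open import Data.Nat using (ℕ; zero; suc; _+_; _*_; _^_; _≤_; _<_; z≤n; s≤s; _<ᵇ_; _≡ᵇ_; _/_; _%_; NonZero)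
open import Data.Nat.DivMod using (m≡m%n+[m/n]*n; m%n<n; m/n*n≤m; m<n*o⇒m/o<n)
open import Data.Nat.ListAction using (sum)
open import Data.Nat.Properties hiding (_≟_)
import Data.Nat.Properties as Nat
open import Data.Nat.Tactic.RingSolver using (solve-∀)
open import Data.Product using (Σ; ∃; ∃₂; _×_; _,_; proj₁; proj₂)
open import Data.Sum using (_⊎_; inj₁; inj₂)
open import Data.Unit using (tt)
open import Data.Vec using (lookup; []; _∷_)
import Data.Vec as Vec
open import Data.Vec.Properties using (lookup∘tabulate; lookup-map; []=⇒lookup)
open import Function using (_∘_; id)
open import Function.Bundles using (_⇔_; mk⇔; module Equivalence)
open import Relation.Binary.Definitions using (tri<; tri≈; tri>)
open import Relation.Binary.PropositionalEquality
open import Relation.Nullary using (¬_; Dec; yes; no; ¬?; _×-dec_)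
open import Relation.Nullary.Decidable using (⌊_⌋; T?; toWitness; fromWitness)

open Equivalence using (to; from)
open import Algebra.Properties.CommutativeSemigroup +-commutativeSemigroup
  using (x∙yz≈xz∙y) renaming (interchange to +-interchange; xy∙z≈xz∙y to +-swapʳ)
module ∑ = CommutativeMonoidSum +-0-commutativeMonoid

private
  variable
    n : ℕ

-- Counting subsets of Fin n

BoolPred : ℕ → Set
BoolPred n = Fin n → Bool

BoolRel : ℕ → Set
BoolRel n = Fin n → Fin n → Bool

𝟙 : Bool → ℕ
𝟙 b = if b then 1 else 0

cnt : BoolPred n → ℕ
cnt P = ∑.sum (λ i → 𝟙 (P i))

infix 4 _⊆ᵇ_
infixr 6 _∩_ _∖_
infixr 5 _∪_

_⊆ᵇ_ : BoolPred n → BoolPred n → Set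
P ⊆ᵇ Q = ∀ i → T (P i) → T (Q i)

_∪_ _∩_ _∖_ : BoolPred n → BoolPred n → BoolPred n
(P ∪ Q) i = P i ∨ Q i
(P ∩ Q) i = P i ∧ Q i
(P ∖ Q) i = P i ∧ not (Q i)

∁ : BoolPred n → BoolPred n
∁ P i = not (P i)

｛_｝ : Fin n → BoolPred n
｛ x ｝ y = ⌊ y ≟ x ⌋

T-not : ∀ {b} → T (not b) ⇔ (¬ T b)
T-not {false} = mk⇔ (λ _ ()) (λ _ → tt)
T-not {true}  = mk⇔ (λ ()) (λ ¬tt → ¬tt tt)

¬T-not⇒T : ∀ {b} → ¬ T (not b) → T b
¬T-not⇒T {true}  _      = tt
¬T-not⇒T {false} ¬⊤     = ¬⊤ tt

x∈｛x｝ : (x : Fin n) → T (｛ x ｝ x)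
x∈｛x｝ x = fromWitness {a? = x ≟ x} refl

∈｛｝⇒≡ : {x y : Fin n} → T (｛ x ｝ y) → y ≡ x
∈｛｝⇒≡ = toWitness

count≡cnt : (P : BoolPred n) → count P ≡ cnt P
count≡cnt {n} P = trans (cong sum (map-tabulate id (𝟙 ∘ P))) (sum-tabulate (𝟙 ∘ P))
  where
  sum-tabulate : ∀ {m} (f : Fin m → ℕ) → sum (tabulate f) ≡ ∑.sum f
  sum-tabulate {zero}  f = refl
  sum-tabulate {suc m} f = cong (f zero +_) (sum-tabulate (f ∘ suc))

cnt-cong : {P Q : BoolPred n} → (∀ i → P i ≡ Q i) → cnt P ≡ cnt Q
cnt-cong P≗Q = ∑.sum-cong-≗ (cong 𝟙 ∘ P≗Q)

cnt-false : cnt {n} (λ _ → false) ≡ 0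
cnt-false {zero}  = refl
cnt-false {suc n} = cnt-false {n}

cnt≤n : (P : BoolPred n) → cnt P ≤ n
cnt≤n {zero}  P = z≤n
cnt≤n {suc n} P with P zero
... | true  = s≤s (cnt≤n (P ∘ suc))
... | false = m≤n⇒m≤1+n (cnt≤n (P ∘ suc))

𝟙-mono : {a b : Bool} → (T a → T b) → 𝟙 a ≤ 𝟙 b
𝟙-mono {false}         _   = z≤n
𝟙-mono {true}  {true}  _   = ≤-refl
𝟙-mono {true}  {false} a⇒b = ⊥-elim (a⇒b tt)

cnt-mono : {P Q : BoolPred n} → P ⊆ᵇ Q → cnt P ≤ cnt Q
cnt-mono {zero}  P⊆Q = z≤n
cnt-mono {suc n} P⊆Q = +-mono-≤ (𝟙-mono (P⊆Q zero)) (cnt-mono (P⊆Q ∘ suc))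

cnt-< : {P Q : BoolPred n} → P ⊆ᵇ Q → (w : Fin n) → T (Q w) → ¬ T (P w) → cnt P < cnt Q
cnt-< {suc n} {P} {Q} P⊆Q zero Qw ¬Pw with P zero | Q zero
... | false | true  = s≤s (cnt-mono (P⊆Q ∘ suc))
... | true  | _     = ⊥-elim (¬Pw tt)
cnt-< {suc n} P⊆Q (suc w) Qw ¬Pw = +-mono-≤-< (𝟙-mono (P⊆Q zero)) (cnt-< (P⊆Q ∘ suc) w Qw ¬Pw)

cnt-∪-∩ : (P Q : BoolPred n) → cnt (P ∪ Q) + cnt (P ∩ Q) ≡ cnt P + cnt Q
cnt-∪-∩ P Q = begin
  cnt (P ∪ Q) + cnt (P ∩ Q)                   ≡⟨ ∑.∑-distrib-+ (𝟙 ∘ (P ∪ Q)) (𝟙 ∘ (P ∩ Q)) ⟨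
  ∑.sum (λ i → 𝟙 ((P ∪ Q) i) + 𝟙 ((P ∩ Q) i)) ≡⟨ ∑.sum-cong-≗ (λ i → 𝟙-∨-∧ (P i) (Q i)) ⟩
  ∑.sum (λ i → 𝟙 (P i) + 𝟙 (Q i))             ≡⟨ ∑.∑-distrib-+ (𝟙 ∘ P) (𝟙 ∘ Q) ⟩
  cnt P + cnt Q                               ∎
  where
  open ≡-Reasoning
  𝟙-∨-∧ : ∀ a b → 𝟙 (a ∨ b) + 𝟙 (a ∧ b) ≡ 𝟙 a + 𝟙 b
  𝟙-∨-∧ false b     = +-identityʳ (𝟙 b)
  𝟙-∨-∧ true  false = refl
  𝟙-∨-∧ true  true  = refl

cnt-∪ : (P Q : BoolPred n) → cnt (P ∪ Q) ≤ cnt P + cnt Q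
cnt-∪ P Q = ≤-trans (m≤m+n _ _) (≤-reflexive (cnt-∪-∩ P Q))

cnt-∪-disjoint : (P Q : BoolPred n) → (∀ i → T (P i) → ¬ T (Q i)) → cnt (P ∪ Q) ≡ cnt P + cnt Q
cnt-∪-disjoint {n} P Q disjoint = begin
  cnt (P ∪ Q)               ≡⟨ +-identityʳ _ ⟨
  cnt (P ∪ Q) + 0           ≡⟨ cong (cnt (P ∪ Q) +_) (trans (cnt-cong P∩Q≗∅) (cnt-false {n})) ⟨
  cnt (P ∪ Q) + cnt (P ∩ Q) ≡⟨ cnt-∪-∩ P Q ⟩
  cnt P + cnt Q             ∎
  where
  open ≡-Reasoning
  P∩Q≗∅ : ∀ i → (P ∩ Q) i ≡ false
  P∩Q≗∅ i with P i in Pi | Q i in Qi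
  ... | false | _     = refl
  ... | true  | false = refl
  ... | true  | true  = ⊥-elim (disjoint i (subst T (sym Pi) tt) (subst T (sym Qi) tt))

cnt-∁ : (P : BoolPred n) → cnt P + cnt (∁ P) ≡ n
cnt-∁ {zero}  P = refl
cnt-∁ {suc n} P = begin
  (𝟙 (P zero) + cnt (P ∘ suc)) + (𝟙 (not (P zero)) + cnt (∁ P ∘ suc))
    ≡⟨ +-interchange (𝟙 (P zero)) (cnt (P ∘ suc)) _ _ ⟩
  (𝟙 (P zero) + 𝟙 (not (P zero))) + (cnt (P ∘ suc) + cnt (∁ P ∘ suc))
    ≡⟨ cong₂ _+_ (𝟙-excluded-middle (P zero)) (cnt-∁ (P ∘ suc)) ⟩
  suc n ∎
  where
  open ≡-Reasoning
  𝟙-excluded-middle : ∀ a → 𝟙 a + 𝟙 (not a) ≡ 1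
  𝟙-excluded-middle false = refl
  𝟙-excluded-middle true  = refl

cnt≤cnt-∖+cnt : (P Q : BoolPred n) → cnt P ≤ cnt (P ∖ Q) + cnt Q
cnt≤cnt-∖+cnt P Q = ≤-trans (cnt-mono P⊆P∖Q∪Q) (cnt-∪ (P ∖ Q) Q)
  where
  P⊆P∖Q∪Q : P ⊆ᵇ (P ∖ Q) ∪ Q
  P⊆P∖Q∪Q i Pi with P i | Q i
  ... | true | false = tt
  ... | true | true  = tt

cnt>0⇒∃ : (P : BoolPred n) → 0 < cnt P → ∃ λ i → T (P i)
cnt>0⇒∃ {suc n} P 0<P with P zero in P0
... | true  = zero , subst T (sym P0) tt
... | false = let i , Pi = cnt>0⇒∃ (P ∘ suc) 0<P in suc i , Pi

cnt≡n⇒∀ : (P : BoolPred n) → cnt P ≡ n → ∀ i → T (P i)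
cnt≡n⇒∀ {n} P P-full i with P i in Pi
... | true  = tt
... | false = ⊥-elim (<-irrefl P-full (<-≤-trans P<⊤ (cnt≤n {n} (λ _ → true))))
  where
  P<⊤ : cnt P < cnt {n} (λ _ → true)
  P<⊤ = cnt-< (λ _ _ → tt) i tt (subst T Pi)

pigeonhole : (P Q : BoolPred n) → n < cnt P + cnt Q → ∃ λ i → T (P i) × T (Q i)
pigeonhole {n} P Q n<P+Q = let i , PQi = cnt>0⇒∃ (P ∩ Q) 0<P∩Q in i , to T-∧ PQi
  where
  open ≤-Reasoning
  0<P∩Q : 0 < cnt (P ∩ Q)
  0<P∩Q = +-cancelˡ-< (cnt (P ∪ Q)) 0 (cnt (P ∩ Q)) (begin-strict
    cnt (P ∪ Q) + 0           ≡⟨ +-identityʳ _ ⟩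
    cnt (P ∪ Q)               ≤⟨ cnt≤n (P ∪ Q) ⟩
    n                         <⟨ n<P+Q ⟩
    cnt P + cnt Q             ≡⟨ cnt-∪-∩ P Q ⟨
    cnt (P ∪ Q) + cnt (P ∩ Q) ∎)

cnt-｛｝ : (x : Fin n) → cnt ｛ x ｝ ≡ 1
cnt-｛｝ {suc n} zero    = cong suc (cnt-false {n})
cnt-｛｝ {suc n} (suc x) = trans (cnt-cong ｛suc｝≗｛｝) (cnt-｛｝ x)
  where
  ｛suc｝≗｛｝ : ∀ i → ｛ suc x ｝ (suc i) ≡ ｛ x ｝ i
  ｛suc｝≗｛｝ i with i ≟ x
  ... | yes _ = refl
  ... | no  _ = refl

cnt-∪-｛｝ : (P : BoolPred n) {x : Fin n} → ¬ T (P x) → cnt (P ∪ ｛ x ｝) ≡ suc (cnt P)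
cnt-∪-｛｝ P {x} x∉P = begin
  cnt (P ∪ ｛ x ｝)  ≡⟨ cnt-∪-disjoint P ｛ x ｝ disjoint ⟩
  cnt P + cnt ｛ x ｝ ≡⟨ cong (cnt P +_) (cnt-｛｝ x) ⟩
  cnt P + 1          ≡⟨ +-comm (cnt P) 1 ⟩
  suc (cnt P)        ∎
  where
  open ≡-Reasoning
  disjoint : ∀ i → T (P i) → ¬ T (｛ x ｝ i)
  disjoint i Pi i≡x with ∈｛｝⇒≡ i≡x
  ... | refl = x∉P Pi

cnt-∘-permute : (π : Permutation′ n) (P : BoolPred n) → cnt (P ∘ (π ⟨$⟩ʳ_)) ≡ cnt P
cnt-∘-permute π P = sym (∑.sum-permute (𝟙 ∘ P) π)

∣∣≡cnt : (S : Subset n) → ∣ S ∣ ≡ cnt (lookup S)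
∣∣≡cnt []            = refl
∣∣≡cnt (true  ∷ S) = cong suc (∣∣≡cnt S)
∣∣≡cnt (false ∷ S) = ∣∣≡cnt S

∣tabulate∣≡cnt : (P : BoolPred n) → ∣ Vec.tabulate P ∣ ≡ cnt P
∣tabulate∣≡cnt P = trans (∣∣≡cnt (Vec.tabulate P)) (cnt-cong (lookup∘tabulate P))

∈⇒T-lookup : ∀ {S : Subset n} {x} → x Subset.∈ S → T (lookup S x)
∈⇒T-lookup x∈S = subst T (sym ([]=⇒lookup x∈S)) tt

-- Degrees and partial matchings

deg⁺ deg⁻ : BoolRel n → Fin n → ℕ
deg⁺ E x = cnt (E x)
deg⁻ E y = cnt (λ x → E x y)

DegreeSum> : BoolRel n → ℕ → Set
DegreeSum> E m = ∀ x y → m < deg⁺ E x + deg⁻ E y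

anyFin : BoolPred n → Bool
anyFin {n} P = any P (allFin n)

anyFin⁺ : (P : BoolPred n) (i : Fin n) → T (P i) → T (anyFin P)
anyFin⁺ P i Pi = any⁺ P (lose (∈-allFin i) Pi)

anyFin⁻ : (P : BoolPred n) → T (anyFin P) → ∃ λ i → T (P i)
anyFin⁻ {n} P ∃P = satisfied (any⁻ P (allFin n) ∃P)

dom : BoolRel n → BoolPred n
dom M x = anyFin (M x)

infix 4 _⊆²_

_⊆²_ : BoolRel n → BoolRel n → Set
M ⊆² E = ∀ x y → T (M x y) → T (E x y)

record IsPartialMatching (E M : BoolRel n) : Set where
  field
    ⊆E         : M ⊆² E
    functional : ∀ {x y y′} → T (M x y) → T (M x y′) → y ≡ y′
    injective  : ∀ {x x′ y} → T (M x y) → T (M x′ y) → x ≡ x′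

Extends : Permutation′ n → BoolRel n → Set
Extends τ M = ∀ {x y} → T (M x y) → τ ⟨$⟩ʳ x ≡ y

∅² : BoolRel n
∅² _ _ = false

∅²-isPartialMatching : {E : BoolRel n} → IsPartialMatching E ∅²
∅²-isPartialMatching = record { ⊆E = λ _ _ () ; functional = λ () ; injective = λ () }

cnt-dom-∅² : cnt (dom {n} ∅²) ≤ 0
cnt-dom-∅² {n} = ≤-trans (cnt-mono {n} {Q = λ _ → false} no-arcs) (≤-reflexive (cnt-false {n}))
  where
  no-arcs : ∀ x → T (dom ∅² x) → ⊥
  no-arcs x x∈dom = proj₂ (anyFin⁻ {n} (λ _ → false) x∈dom)

isPartialMatching-⊆ : ∀ {E E′ M : BoolRel n} → E ⊆² E′ → IsPartialMatching E M → IsPartialMatching E′ M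
isPartialMatching-⊆ E⊆E′ M-matching = record
  { ⊆E = λ x y Mxy → E⊆E′ x y (⊆E x y Mxy) ; functional = functional ; injective = injective }
  where open IsPartialMatching M-matching

infixr 6 _∖²_

_∖²_ : BoolRel n → BoolRel n → BoolRel n
(E ∖² N) x = E x ∖ N x

∖²-isPartialMatching : ∀ {E M} (N : BoolRel n) → IsPartialMatching E M → IsPartialMatching (E ∖² N) (M ∖² N)
∖²-isPartialMatching N M-matching = record
  { ⊆E         = λ x y M∖Nxy → let Mxy , ¬Nxy = to T-∧ M∖Nxy in from T-∧ (⊆E x y Mxy , ¬Nxy)
  ; functional = λ Mxy Mxy′ → functional (proj₁ (to T-∧ Mxy)) (proj₁ (to T-∧ Mxy′))
  ; injective  = λ Mxy Mx′y → injective (proj₁ (to T-∧ Mxy)) (proj₁ (to T-∧ Mx′y))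
  }
  where open IsPartialMatching M-matching

dom-∖² : (M N : BoolRel n) → dom (M ∖² N) ⊆ᵇ dom M
dom-∖² M N x x∈dom = let y , M∖Nxy = anyFin⁻ _ x∈dom in anyFin⁺ (M x) y (proj₁ (to T-∧ M∖Nxy))

-- τ has all its arcs x → τ x in twist E π iff x ↦ π (τ x), that is τ ∘ₚ π, has all its arcs in E.
twist : BoolRel n → Permutation′ n → BoolRel n
twist E π x z = E x (π ⟨$⟩ʳ z)

twist-dense : ∀ {E : BoolRel n} {m} (π : Permutation′ n) → DegreeSum> E m → DegreeSum> (twist E π) m
twist-dense {E = E} {m} π E-dense x z =
  subst (λ d → m < d + deg⁻ E (π ⟨$⟩ʳ z)) (sym (cnt-∘-permute π (E x))) (E-dense x (π ⟨$⟩ʳ z))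

-- Extending a partial matching to a permutation

module _ (i j : Fin n) where

  transpose-applyˡ : transpose i j ⟨$⟩ʳ i ≡ j
  transpose-applyˡ with i ≟ i
  ... | yes _   = refl
  ... | no i≢i = ⊥-elim (i≢i refl)

  transpose-applyʳ : transpose i j ⟨$⟩ʳ j ≡ i
  transpose-applyʳ with j ≟ i
  ... | yes refl = refl
  ... | no  _ with j ≟ j
  ...   | yes _   = refl
  ...   | no j≢j = ⊥-elim (j≢j refl)

  transpose-apply-other : ∀ {k} → k ≢ i → k ≢ j → transpose i j ⟨$⟩ʳ k ≡ k
  transpose-apply-other {k} k≢i k≢j with k ≟ i
  ... | yes k≡i = ⊥-elim (k≢i k≡i)
  ... | no  _ with k ≟ j
  ...   | yes k≡j = ⊥-elim (k≢j k≡j)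
  ...   | no  _   = refl

module PerfectMatching {n} {E M : BoolRel n} (M-matching : IsPartialMatching E M) where
  open IsPartialMatching M-matching

  private
    extending-on : (xs : List (Fin n)) →
      Σ (Permutation′ n) λ τ → ∀ {x y} → x ∈ xs → T (M x y) → τ ⟨$⟩ʳ x ≡ y
    extending-on []       = Permutation.id , λ ()
    extending-on (u ∷ xs) with extending-on xs | any? (λ v → T? (M u v))
    ... | τ , τ-ok | no  ¬Mu    = τ , λ { (here refl) Muy → ⊥-elim (¬Mu (_ , Muy)) ; (there x∈) → τ-ok x∈ }
    ... | τ , τ-ok | yes (v , Muv) = transpose u w ∘ₚ τ , τ′-ok
      where
      w = τ ⟨$⟩ˡ v
      τ′u≡v : τ ⟨$⟩ʳ (transpose u w ⟨$⟩ʳ u) ≡ v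
      τ′u≡v = trans (cong (τ ⟨$⟩ʳ_) (transpose-applyˡ u w)) (inverseʳ τ)
      τ′-ok : ∀ {x y} → x ∈ u ∷ xs → T (M x y) → τ ⟨$⟩ʳ (transpose u w ⟨$⟩ʳ x) ≡ y
      τ′-ok (here refl)          Mxy = trans τ′u≡v (functional Muv Mxy)
      τ′-ok {x} {y} (there x∈xs) Mxy = by-cases (x ≟ u)
        where
        by-cases : Dec (x ≡ u) → τ ⟨$⟩ʳ (transpose u w ⟨$⟩ʳ x) ≡ y
        by-cases (yes refl) = trans τ′u≡v (functional Muv Mxy)
        by-cases (no x≢u)   =
          trans (cong (τ ⟨$⟩ʳ_) (transpose-apply-other u w x≢u x≢w)) (τ-ok x∈xs Mxy)
          where
          x≢w : x ≢ w
          x≢w refl = x≢u (injective (subst (T ∘ M x) (trans (sym (τ-ok x∈xs Mxy)) (inverseʳ τ)) Mxy) Muv)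

  permutation-extending : Σ (Permutation′ n) λ τ → Extends τ M
  permutation-extending = let τ , τ-ok = extending-on (allFin _) in τ , τ-ok (∈-allFin _)

  module _ {L : ℕ} (dom-M≤L : cnt (dom M) ≤ L) (E-dense : DegreeSum> E (n + L)) where

    private
      Good : Permutation′ n → Fin n → Set
      Good τ x = T (E x (τ ⟨$⟩ʳ x))

      swap-partner : (τ : Permutation′ n) (u : Fin n) →
        ∃ λ w → T (E u (τ ⟨$⟩ʳ w)) × ¬ T (dom M w) × T (E w (τ ⟨$⟩ʳ u))
      swap-partner τ u =
        let w , Aw , Bw = pigeonhole A B n<A+B
            Euτw , w∉dom = to T-∧ Aw
        in w , Euτw , to T-not w∉dom , Bw
        where
        open ≤-Reasoning
        A B : BoolPred n
        A = (E u ∘ (τ ⟨$⟩ʳ_)) ∖ dom M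
        B w = E w (τ ⟨$⟩ʳ u)
        deg⁺≤A+L : deg⁺ E u ≤ cnt A + L
        deg⁺≤A+L = begin
          deg⁺ E u                   ≡⟨ cnt-∘-permute τ (E u) ⟨
          cnt (E u ∘ (τ ⟨$⟩ʳ_))      ≤⟨ cnt≤cnt-∖+cnt (E u ∘ (τ ⟨$⟩ʳ_)) (dom M) ⟩
          cnt A + cnt (dom M)        ≤⟨ +-monoʳ-≤ (cnt A) dom-M≤L ⟩
          cnt A + L                  ∎
        n<A+B : n < cnt A + cnt B
        n<A+B = +-cancelʳ-< L n (cnt A + cnt B) (begin-strict
          n + L                        <⟨ E-dense u (τ ⟨$⟩ʳ u) ⟩
          deg⁺ E u + deg⁻ E (τ ⟨$⟩ʳ u) ≤⟨ +-monoˡ-≤ (cnt B) deg⁺≤A+L ⟩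
          cnt A + L + cnt B            ≡⟨ +-swapʳ (cnt A) L (cnt B) ⟩
          cnt A + cnt B + L            ∎)

      repair : (τ : Permutation′ n) → Extends τ M → (u : Fin n) →
        Σ (Permutation′ n) λ τ′ → Extends τ′ M × Good τ′ u × (∀ x → Good τ x → Good τ′ x)
      repair τ τ-ext u with T? (E u (τ ⟨$⟩ʳ u)) | swap-partner τ u
      ... | yes good-u | _                          = τ , τ-ext , good-u , λ _ good-x → good-x
      ... | no  bad-u  | w , Euτw , w∉dom-M , Ewτu = τ′ , τ′-ext , τ′-good-u , τ′-preserves
        where
        τ′ = transpose u w ∘ₚ τ
        τ′-ext : Extends τ′ M
        τ′-ext {x} Mxy = trans (cong (τ ⟨$⟩ʳ_) (transpose-apply-other u w x≢u x≢w)) (τ-ext Mxy)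
          where
          x≢u : x ≢ u
          x≢u refl = bad-u (subst (T ∘ E x) (sym (τ-ext Mxy)) (⊆E x _ Mxy))
          x≢w : x ≢ w
          x≢w refl = w∉dom-M (anyFin⁺ (M x) _ Mxy)
        τ′-good-u : Good τ′ u
        τ′-good-u = subst (T ∘ E u) (sym (cong (τ ⟨$⟩ʳ_) (transpose-applyˡ u w))) Euτw
        τ′-preserves : ∀ x → Good τ x → Good τ′ x
        τ′-preserves x good-x = by-cases (x ≟ u) (x ≟ w)
          where
          by-cases : Dec (x ≡ u) → Dec (x ≡ w) → Good τ′ x
          by-cases (yes refl) _          = τ′-good-u
          by-cases (no _)     (yes refl) =
            subst (T ∘ E x) (sym (cong (τ ⟨$⟩ʳ_) (transpose-applyʳ u w))) Ewτu
          by-cases (no x≢u)   (no x≢w)   =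
            subst (T ∘ E x) (sym (cong (τ ⟨$⟩ʳ_) (transpose-apply-other u w x≢u x≢w))) good-x

      repair-all : (xs : List (Fin n)) →
        Σ (Permutation′ n) λ τ → Extends τ M × ∀ {x} → x ∈ xs → Good τ x
      repair-all []       = proj₁ permutation-extending , proj₂ permutation-extending , λ ()
      repair-all (u ∷ xs) =
        let τ , τ-ext , τ-good = repair-all xs
            τ′ , τ′-ext , τ′-good-u , τ′-preserves = repair τ τ-ext u
        in τ′ , τ′-ext , λ { (here refl) → τ′-good-u ; (there x∈xs) → τ′-preserves _ (τ-good x∈xs) }

    perfectMatching-extending : Σ (Permutation′ n) λ τ → (∀ x → T (E x (τ ⟨$⟩ʳ x))) × Extends τ M
    perfectMatching-extending =
      let τ , τ-ext , τ-good = repair-all (allFin n) in τ , (λ x → τ-good (∈-allFin x)) , τ-ext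

-- Greedy growth of a reachable set

Grown : BoolPred n → BoolPred n → ℕ → Set
Grown {n} C C′ m = cnt C′ ≡ n ⊎ cnt C + m ≤ cnt C′

Grown-trans : ∀ {C C₁ C₂ : BoolPred n} {m m′} → C₁ ⊆ᵇ C₂ → Grown C C₁ m → Grown C₁ C₂ m′ → Grown C C₂ (m′ + m)
Grown-trans                          _     _            (inj₁ C₂-full) = inj₁ C₂-full
Grown-trans {n} {C₂ = C₂}            C₁⊆C₂ (inj₁ C₁-full) (inj₂ _)     =
  inj₁ (≤-antisym (cnt≤n C₂) (subst (_≤ cnt C₂) C₁-full (cnt-mono C₁⊆C₂)))
Grown-trans {C = C} {C₁} {C₂} {m} {m′} _ (inj₂ C₁-big) (inj₂ C₂-big) = inj₂ (begin
  cnt C + (m′ + m)  ≡⟨ x∙yz≈xz∙y (cnt C) m′ m ⟩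
  cnt C + m + m′    ≤⟨ +-monoˡ-≤ m′ C₁-big ⟩
  cnt C₁ + m′       ≤⟨ C₂-big ⟩
  cnt C₂            ∎)
  where open ≤-Reasoning

data Reachable (M : BoolRel n) (C : BoolPred n) : Fin n → Set where
  start : ∀ {y} → T (C y) → Reachable M C y
  step  : ∀ {x y} → Reachable M C x → T (M x y) → Reachable M C y

Reachable-mono : ∀ {M M′ : BoolRel n} {C y} → M ⊆² M′ → Reachable M C y → Reachable M′ C y
Reachable-mono M⊆M′ (start Cy)    = start Cy
Reachable-mono M⊆M′ (step r Mxy) = step (Reachable-mono M⊆M′ r) (M⊆M′ _ _ Mxy)

Reachable⇒∈ : ∀ {M : BoolRel n} {C y} (S : BoolPred n) →
  (∀ x y → T (M x y) → T (S x) → T (S y)) → C ⊆ᵇ S → Reachable M C y → T (S y)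
Reachable⇒∈ S M-closed C⊆S (start Cy)   = C⊆S _ Cy
Reachable⇒∈ S M-closed C⊆S (step r Mxy) = M-closed _ _ Mxy (Reachable⇒∈ S M-closed C⊆S r)

_⊕_ : BoolRel n → Fin n × Fin n → BoolRel n
(M ⊕ (s , x)) a b = M a b ∨ (｛ s ｝ a ∧ ｛ x ｝ b)

module _ {M : BoolRel n} {s x : Fin n} where

  ⊕-old : M ⊆² M ⊕ (s , x)
  ⊕-old a b Mab = from T-∨ (inj₁ Mab)

  ⊕-new : T ((M ⊕ (s , x)) s x)
  ⊕-new = from (T-∨ {M s x}) (inj₂ (from T-∧ (x∈｛x｝ s , x∈｛x｝ x)))

  ⊕-cases : ∀ {a b} → T ((M ⊕ (s , x)) a b) → T (M a b) ⊎ (a ≡ s × b ≡ x)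
  ⊕-cases Mab with to T-∨ Mab
  ... | inj₁ old = inj₁ old
  ... | inj₂ new = let a≡s , b≡x = to T-∧ new in inj₂ (∈｛｝⇒≡ a≡s , ∈｛｝⇒≡ b≡x)

  cnt-dom-⊕ : cnt (dom (M ⊕ (s , x))) ≤ suc (cnt (dom M))
  cnt-dom-⊕ = begin
    cnt (dom (M ⊕ (s , x)))   ≤⟨ cnt-mono dom-⊕⊆ ⟩
    cnt (dom M ∪ ｛ s ｝)      ≤⟨ cnt-∪ (dom M) ｛ s ｝ ⟩
    cnt (dom M) + cnt ｛ s ｝  ≡⟨ cong (cnt (dom M) +_) (cnt-｛｝ s) ⟩
    cnt (dom M) + 1           ≡⟨ +-comm (cnt (dom M)) 1 ⟩
    suc (cnt (dom M))         ∎
    where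
    open ≤-Reasoning
    dom-⊕⊆ : dom (M ⊕ (s , x)) ⊆ᵇ dom M ∪ ｛ s ｝
    dom-⊕⊆ a a∈dom with anyFin⁻ _ a∈dom
    ... | b , Mab with ⊕-cases Mab
    ...   | inj₁ old          = from T-∨ (inj₁ (anyFin⁺ (M a) b old))
    ...   | inj₂ (refl , refl) = from (T-∨ {dom M s}) (inj₂ (x∈｛x｝ s))

  ⊕-isPartialMatching : ∀ {R} → IsPartialMatching R M → ¬ T (dom M s) → (∀ a → ¬ T (M a x)) →
    T (R s x) → IsPartialMatching R (M ⊕ (s , x))
  ⊕-isPartialMatching {R} M-matching s∉dom x∉ran Rsx = record
    { ⊆E = ⊆R ; functional = functional′ ; injective = injective′ }
    where
    open IsPartialMatching M-matching
    ⊆R : M ⊕ (s , x) ⊆² R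
    ⊆R a b Mab with ⊕-cases Mab
    ... | inj₁ old          = ⊆E a b old
    ... | inj₂ (refl , refl) = Rsx
    functional′ : ∀ {a b b′} → T ((M ⊕ (s , x)) a b) → T ((M ⊕ (s , x)) a b′) → b ≡ b′
    functional′ Mab Mab′ with ⊕-cases Mab | ⊕-cases Mab′
    ... | inj₁ old          | inj₁ old′         = functional old old′
    ... | inj₁ old          | inj₂ (refl , refl) = ⊥-elim (s∉dom (anyFin⁺ (M s) _ old))
    ... | inj₂ (refl , refl) | inj₁ old′         = ⊥-elim (s∉dom (anyFin⁺ (M s) _ old′))
    ... | inj₂ (refl , refl) | inj₂ (_ , refl)   = refl
    injective′ : ∀ {a a′ b} → T ((M ⊕ (s , x)) a b) → T ((M ⊕ (s , x)) a′ b) → a ≡ a′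
    injective′ Mab Ma′b with ⊕-cases Mab | ⊕-cases Ma′b
    ... | inj₁ old          | inj₁ old′         = injective old old′
    ... | inj₁ old          | inj₂ (refl , refl) = ⊥-elim (x∉ran _ old)
    ... | inj₂ (refl , refl) | inj₁ old′         = ⊥-elim (x∉ran _ old′)
    ... | inj₂ (refl , refl) | inj₂ (refl , _)   = refl

module _ {n} {R : BoolRel n} {L : ℕ} (R-dense : DegreeSum> R (n + L)) (C D : BoolPred n) (D≤L : cnt D ≤ L) where

  arc-entering : ∀ {s x} → R s ⊆ᵇ C → ¬ T (C x) → ∃ λ z → T ((C ∖ D) z) × T (R z x)
  arc-entering {s} {x} N⁺s⊆C x∉C =
    let z , Good-z = cnt>0⇒∃ Good Good-nonempty ; Rzx , z∈C∖D = to T-∧ Good-z in z , z∈C∖D , Rzx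
    where
    open ≤-Reasoning
    Good : BoolPred n
    Good z = R z x ∧ (C ∖ D) z
    N⁻x⊆ : (λ z → R z x) ⊆ᵇ Good ∪ (∁ C ∪ D)
    N⁻x⊆ z Rzx with R z x | C z | D z
    ... | true | true  | false = tt
    ... | true | true  | true  = tt
    ... | true | false | _     = tt
    deg⁻x-bound : deg⁻ R x ≤ cnt Good + (cnt (∁ C) + L)
    deg⁻x-bound = begin
      deg⁻ R x                           ≤⟨ cnt-mono N⁻x⊆ ⟩
      cnt (Good ∪ (∁ C ∪ D))             ≤⟨ cnt-∪ Good (∁ C ∪ D) ⟩
      cnt Good + cnt (∁ C ∪ D)           ≤⟨ +-monoʳ-≤ (cnt Good) (cnt-∪ (∁ C) D) ⟩
      cnt Good + (cnt (∁ C) + cnt D)     ≤⟨ +-monoʳ-≤ (cnt Good) (+-monoʳ-≤ (cnt (∁ C)) D≤L) ⟩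
      cnt Good + (cnt (∁ C) + L)         ∎
    rearrange : ∀ a b c d → a + (b + (c + d)) ≡ (a + c) + (b + d)
    rearrange = solve-∀
    Good-nonempty : 0 < cnt Good
    Good-nonempty = +-cancelʳ-< L 0 (cnt Good) (+-cancelˡ-< n L (cnt Good + L) (begin-strict
      n + L                                  <⟨ R-dense s x ⟩
      deg⁺ R s + deg⁻ R x                    ≤⟨ +-mono-≤ (cnt-mono N⁺s⊆C) deg⁻x-bound ⟩
      cnt C + (cnt Good + (cnt (∁ C) + L))   ≡⟨ rearrange (cnt C) (cnt Good) (cnt (∁ C)) L ⟩
      (cnt C + cnt (∁ C)) + (cnt Good + L)   ≡⟨ cong (_+ (cnt Good + L)) (cnt-∁ C) ⟩
      n + (cnt Good + L)                     ∎))

  arc-leaving : cnt D < cnt C → cnt C < n → ∃₂ λ s x → T (C s) × ¬ T (D s) × ¬ T (C x) × T (R s x)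
  arc-leaving D<C C<n = from-source (cnt>0⇒∃ (C ∖ D) C∖D-nonempty)
    where
    open ≤-Reasoning
    C∖D-nonempty : 0 < cnt (C ∖ D)
    C∖D-nonempty = +-cancelʳ-< (cnt D) 0 _ (<-≤-trans D<C (cnt≤cnt-∖+cnt C D))
    ∁C-nonempty : 0 < cnt (∁ C)
    ∁C-nonempty = +-cancelˡ-< (cnt C) 0 _ (begin-strict
      cnt C + 0         ≡⟨ +-identityʳ (cnt C) ⟩
      cnt C             <⟨ C<n ⟩
      n                 ≡⟨ cnt-∁ C ⟨
      cnt C + cnt (∁ C) ∎)
    from-source : ∃ (λ s → T ((C ∖ D) s)) → ∃₂ λ s x → T (C s) × ¬ T (D s) × ¬ T (C x) × T (R s x)
    from-source (s , s∈C∖D) with to T-∧ s∈C∖D | any? (λ x → T? ((R s ∖ C) x)) | cnt>0⇒∃ (∁ C) ∁C-nonempty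
    ... | Cs , ¬Ds | yes (x , Rsx∖Cx) | _ =
      let Rsx , ¬Cx = to T-∧ Rsx∖Cx in s , x , Cs , to T-not ¬Ds , to T-not ¬Cx , Rsx
    ... | _ | no N⁺s⊈∁C | x , ¬Cx =
      let z , z∈C∖D , Rzx = arc-entering N⁺s⊆C (to T-not ¬Cx) ; Cz , ¬Dz = to T-∧ z∈C∖D
      in z , x , Cz , to T-not ¬Dz , to T-not ¬Cx , Rzx
      where
      N⁺s⊆C : R s ⊆ᵇ C
      N⁺s⊆C y Rsy with T? (C y)
      ... | yes Cy = Cy
      ... | no ¬Cy = ⊥-elim (N⁺s⊈∁C (y , from (T-∧ {R s y}) (Rsy , from T-not ¬Cy)))

module Growth {n} {R : BoolRel n} {L : ℕ} (R-dense : DegreeSum> R (n + L))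
              (C₀ : BoolPred n) (C₀-nonempty : 1 ≤ cnt C₀) where

  record Stage (k : ℕ) : Set where
    field
      reached        : BoolPred n
      arcs           : BoolRel n
      matching       : IsPartialMatching R arcs
      heads-reached  : ∀ {a b} → T (arcs a b) → T (reached b)
      dom-size       : cnt (dom arcs) ≤ k
      size           : cnt reached ≡ cnt C₀ + k
      C₀⊆reached     : C₀ ⊆ᵇ reached
      reachable      : ∀ {y} → T (reached y) → Reachable arcs C₀ y

  initial : Stage 0
  initial = record
    { reached       = C₀
    ; arcs          = ∅²
    ; matching      = ∅²-isPartialMatching
    ; heads-reached = λ ()
    ; dom-size      = cnt-dom-∅² {n}
    ; size          = sym (+-identityʳ (cnt C₀))
    ; C₀⊆reached    = λ _ C₀y → C₀y
    ; reachable     = start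
    }

  grow-step : ∀ {k} (g : Stage k) → k < L → cnt (Stage.reached g) < n → Stage (suc k)
  grow-step {k} g k<L not-full =
    add-arc (arc-leaving R-dense reached (dom arcs) (≤-trans dom-size (<⇒≤ k<L)) dom<reached not-full)
    where
    open Stage g
    dom<reached : cnt (dom arcs) < cnt reached
    dom<reached = begin-strict
      cnt (dom arcs) ≤⟨ dom-size ⟩
      k              <⟨ +-monoˡ-≤ k C₀-nonempty ⟩
      cnt C₀ + k     ≡⟨ size ⟨
      cnt reached    ∎
      where open ≤-Reasoning
    add-arc : (∃₂ λ s x → T (reached s) × ¬ T (dom arcs s) × ¬ T (reached x) × T (R s x)) → Stage (suc k)
    add-arc (s , x , s∈reached , s∉dom , x∉reached , Rsx) = record
      { reached       = reached ∪ ｛ x ｝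
      ; arcs          = arcs ⊕ (s , x)
      ; matching      = ⊕-isPartialMatching matching s∉dom (λ a Max → x∉reached (heads-reached Max)) Rsx
      ; heads-reached = heads-reached′
      ; dom-size      = ≤-trans (cnt-dom-⊕ {M = arcs} {s} {x}) (s≤s dom-size)
      ; size          = trans (cnt-∪-｛｝ reached x∉reached) (trans (cong suc size) (sym (+-suc (cnt C₀) k)))
      ; C₀⊆reached    = λ y C₀y → from T-∨ (inj₁ (C₀⊆reached y C₀y))
      ; reachable     = reachable′
      }
      where
      heads-reached′ : ∀ {a b} → T ((arcs ⊕ (s , x)) a b) → T ((reached ∪ ｛ x ｝) b)
      heads-reached′ ab with ⊕-cases {M = arcs} {s} {x} ab
      ... | inj₁ old          = from T-∨ (inj₁ (heads-reached old))
      ... | inj₂ (refl , refl) = from (T-∨ {reached x}) (inj₂ (x∈｛x｝ x))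
      reachable′ : ∀ {y} → T ((reached ∪ ｛ x ｝) y) → Reachable (arcs ⊕ (s , x)) C₀ y
      reachable′ {y} y∈ with to (T-∨ {reached y}) y∈
      ... | inj₁ old = Reachable-mono (⊕-old {M = arcs} {s} {x}) (reachable old)
      ... | inj₂ y≡x with ∈｛｝⇒≡ y≡x
      ...   | refl = step (Reachable-mono (⊕-old {M = arcs} {s} {x}) (reachable s∈reached)) (⊕-new {M = arcs})

  grow : ∀ {k} (m : ℕ) → k + m ≤ L → Stage k → ∃ λ k′ → k′ ≤ L × Σ (Stage k′) λ g → Grown C₀ (Stage.reached g) (k + m)
  grow {k} zero    k≤L g =
    k , subst (_≤ L) (+-identityʳ k) k≤L , g , inj₂ (≤-reflexive (trans (cong (cnt C₀ +_) (+-identityʳ k)) (sym (Stage.size g))))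
  grow {k} (suc m) k+1+m≤L g with cnt (Stage.reached g) Nat.≟ n
  ... | yes full  = k , ≤-trans (m≤m+n k (suc m)) k+1+m≤L , g , inj₁ full
  ... | no  ¬full =
    let k′ , k′≤L , g′ , grown = grow m (subst (_≤ L) (+-suc k m) k+1+m≤L)
                                   (grow-step g (<-≤-trans (m<m+n k (s≤s z≤n)) k+1+m≤L) (≤∧≢⇒< (cnt≤n _) ¬full))
    in k′ , k′≤L , g′ , subst (Grown C₀ (Stage.reached g′)) (sym (+-suc k m)) grown

  greedy : ∃ λ k → k ≤ L × Σ (Stage k) λ g → Grown C₀ (Stage.reached g) L
  greedy = grow L ≤-refl initial

-- Unions of arc-disjoint permutations

_∈ᵇ_ : Fin n → List (Fin n) → Bool
y ∈ᵇ vs = any (λ v → ｛ v ｝ y) vs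

∈ᵇ⁺ : ∀ {y} {vs : List (Fin n)} → y ∈ vs → T (y ∈ᵇ vs)
∈ᵇ⁺ {y = y} y∈vs = any⁺ _ (Any.map (λ { refl → x∈｛x｝ y }) y∈vs)

∈ᵇ⁻ : ∀ {y} (vs : List (Fin n)) → T (y ∈ᵇ vs) → y ∈ vs
∈ᵇ⁻ vs y∈vs = Any.map ∈｛｝⇒≡ (any⁻ _ vs y∈vs)

cnt-∈ᵇ : (vs : List (Fin n)) → Unique vs → cnt (_∈ᵇ vs) ≡ length vs
cnt-∈ᵇ {n} []       []               = cnt-false {n}
cnt-∈ᵇ     (v ∷ vs) (v∉vs ∷ vs-unique) = begin
  cnt (｛ v ｝ ∪ (_∈ᵇ vs))      ≡⟨ cnt-∪-disjoint ｛ v ｝ (_∈ᵇ vs) disjoint ⟩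
  cnt ｛ v ｝ + cnt (_∈ᵇ vs)    ≡⟨ cong₂ _+_ (cnt-｛｝ v) (cnt-∈ᵇ vs vs-unique) ⟩
  suc (length vs)              ∎
  where
  open ≡-Reasoning
  disjoint : ∀ y → T (｛ v ｝ y) → ¬ T (y ∈ᵇ vs)
  disjoint y y≡v y∈vs with ∈｛｝⇒≡ y≡v
  ... | refl = All.lookup v∉vs (∈ᵇ⁻ vs y∈vs) refl

closed⇒∁-closed : (π : Permutation′ n) (S : BoolPred n) →
  S ⊆ᵇ S ∘ (π ⟨$⟩ʳ_) → ∀ x → ¬ T (S x) → ¬ T (S (π ⟨$⟩ʳ x))
closed⇒∁-closed π S S⊆S∘π x ¬Sx Sπx = <-irrefl (sym (cnt-∘-permute π S)) (cnt-< S⊆S∘π x Sπx ¬Sx)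

module Connectivity {n} (σ₀ : Permutation′ n) (v₀ : Fin n) where

  -- N⁺(S) contains σ₀(S), and contains it strictly exactly when S is not closed.
  Closed : List (Permutation′ n) → BoolPred n → Set
  Closed ps S = ∀ {σ} → σ ∈ ps → ∀ x → T (S x) → T (S (σ₀ ⟨$⟩ˡ (σ ⟨$⟩ʳ x)))

  Reaches : List (Permutation′ n) → BoolPred n → Set
  Reaches ps C = ∀ S → Closed ps S → T (S v₀) → C ⊆ᵇ S

  Spanning : List (Permutation′ n) → Set
  Spanning ps = Reaches ps (λ _ → true)

  Closed-anti : ∀ {ps ps′} → (∀ {σ} → σ ∈ ps → σ ∈ ps′) → ∀ {S} → Closed ps′ S → Closed ps S
  Closed-anti ps⊆ps′ closed σ∈ = closed (ps⊆ps′ σ∈)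

  Closed-∁ : ∀ {ps S} → Closed ps S → Closed ps (∁ S)
  Closed-∁ {S = S} closed {σ} σ∈ x ¬Sx = from T-not (closed⇒∁-closed (σ ∘ₚ Permutation.flip σ₀) S (closed σ∈) x (to T-not ¬Sx))

  proper-not-closed : ∀ {ps} → Spanning ps → ∀ {S} → Closed ps S → ∀ {a b} → T (S a) → ¬ T (S b) → ⊥
  proper-not-closed spanning {S} closed {a} {b} Sa ¬Sb with T? (S v₀)
  ... | yes Sv₀  = ¬Sb (spanning S closed Sv₀ b tt)
  ... | no  ¬Sv₀ = to T-not (spanning (∁ S) (Closed-∁ closed) (from T-not ¬Sv₀) a tt) Sa

  escape : ∀ {ps} → Spanning ps → (S : BoolPred n) {a b : Fin n} → T (S a) → ¬ T (S b) →
    ∃₂ λ σ x → σ ∈ ps × T (S x) × ¬ T (S (σ₀ ⟨$⟩ˡ (σ ⟨$⟩ʳ x)))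
  escape {ps} spanning S Sa ¬Sb
    with any? (λ x → T? (S x) ×-dec Any.any? (λ σ → ¬? (T? (S (σ₀ ⟨$⟩ˡ (σ ⟨$⟩ʳ x))))) ps)
  ... | yes (x , Sx , leaves) = let σ , σ∈ , ¬Sσx = find leaves in σ , x , σ∈ , Sx , ¬Sσx
  ... | no  stays             = ⊥-elim (proper-not-closed spanning closed Sa ¬Sb)
    where
    closed : Closed ps S
    closed {σ} σ∈ x Sx with T? (S (σ₀ ⟨$⟩ˡ (σ ⟨$⟩ʳ x)))
    ... | yes Sσx = Sσx
    ... | no ¬Sσx = ⊥-elim (stays (x , Sx , lose σ∈ ¬Sσx))

ArcDisjoint : List (Permutation′ n) → Set
ArcDisjoint = AllPairs (λ σ τ → ∀ x → σ ⟨$⟩ʳ x ≢ τ ⟨$⟩ʳ x)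

arcsOf : List (Permutation′ n) → BoolRel n
arcsOf ps x y = y ∈ᵇ map (_⟨$⟩ʳ x) ps

arcsOf⁺ : ∀ {ps} {σ : Permutation′ n} → σ ∈ ps → ∀ x → T (arcsOf ps x (σ ⟨$⟩ʳ x))
arcsOf⁺ σ∈ x = ∈ᵇ⁺ (∈-map⁺ (_⟨$⟩ʳ x) σ∈)

arcsOf⁻ : ∀ {ps} {x y : Fin n} → T (arcsOf ps x y) → ∃ λ σ → σ ∈ ps × y ≡ σ ⟨$⟩ʳ x
arcsOf⁻ {x = x} xy = ∈-map⁻ (_⟨$⟩ʳ x) (∈ᵇ⁻ _ xy)

arcsOf-mono : ∀ {ps ps′ : List (Permutation′ n)} → (∀ {σ} → σ ∈ ps → σ ∈ ps′) → arcsOf ps ⊆² arcsOf ps′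
arcsOf-mono {ps = ps} ps⊆ps′ x y xy with arcsOf⁻ {ps = ps} {x} {y} xy
... | σ , σ∈ , refl = arcsOf⁺ (ps⊆ps′ σ∈) x

module _ {n} {ps : List (Permutation′ n)} (disjoint : ArcDisjoint ps) where

  deg⁺-arcsOf : ∀ x → deg⁺ (arcsOf ps) x ≡ length ps
  deg⁺-arcsOf x = begin
    cnt (_∈ᵇ map (_⟨$⟩ʳ x) ps) ≡⟨ cnt-∈ᵇ _ (AllPairs.map⁺ (AllPairs.map (λ σ≠τ → σ≠τ x) disjoint)) ⟩
    length (map (_⟨$⟩ʳ x) ps)  ≡⟨ length-map _ ps ⟩
    length ps                  ∎
    where open ≡-Reasoning

  deg⁻-arcsOf : ∀ y → deg⁻ (arcsOf ps) y ≡ length ps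
  deg⁻-arcsOf y = begin
    cnt (λ z → arcsOf ps z y)  ≡⟨ ≤-antisym (cnt-mono arc⇒pred) (cnt-mono pred⇒arc) ⟩
    cnt (_∈ᵇ map (_⟨$⟩ˡ y) ps) ≡⟨ cnt-∈ᵇ _ predecessors-unique ⟩
    length (map (_⟨$⟩ˡ y) ps)  ≡⟨ length-map _ ps ⟩
    length ps                  ∎
    where
    open ≡-Reasoning
    differ : ∀ {σ τ : Permutation′ n} → (∀ z → σ ⟨$⟩ʳ z ≢ τ ⟨$⟩ʳ z) → σ ⟨$⟩ˡ y ≢ τ ⟨$⟩ˡ y
    differ {σ} {τ} σ≠τ σ⁻¹y≡τ⁻¹y =
      σ≠τ (σ ⟨$⟩ˡ y) (trans (inverseʳ σ {y}) (trans (sym (inverseʳ τ {y})) (cong (τ ⟨$⟩ʳ_) (sym σ⁻¹y≡τ⁻¹y))))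
    predecessors-unique : Unique (map (_⟨$⟩ˡ y) ps)
    predecessors-unique = AllPairs.map⁺ {f = _⟨$⟩ˡ y} (AllPairs.map (λ {σ} {τ} → differ {σ} {τ}) disjoint)
    arc⇒pred : ∀ z → T (arcsOf ps z y) → T (z ∈ᵇ map (_⟨$⟩ˡ y) ps)
    arc⇒pred z zy = let σ , σ∈ , y≡σz = arcsOf⁻ zy in
      ∈ᵇ⁺ (subst (_∈ map (_⟨$⟩ˡ y) ps) (trans (cong (σ ⟨$⟩ˡ_) y≡σz) (inverseˡ σ)) (∈-map⁺ (_⟨$⟩ˡ y) σ∈))
    pred⇒arc : ∀ z → T (z ∈ᵇ map (_⟨$⟩ˡ y) ps) → T (arcsOf ps z y)
    pred⇒arc z z∈ = let σ , σ∈ , z≡σ⁻¹y = ∈-map⁻ (_⟨$⟩ˡ y) (∈ᵇ⁻ (map (_⟨$⟩ˡ y) ps) z∈) in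
      subst (T ∘ arcsOf ps z) (trans (cong (σ ⟨$⟩ʳ_) z≡σ⁻¹y) (inverseʳ σ)) (arcsOf⁺ {ps = ps} σ∈ z)

module Union {n} (ps : List (Permutation′ n))
             (fixed-point-free : ∀ {σ} → σ ∈ ps → ∀ x → σ ⟨$⟩ʳ x ≢ x) where

  H : Digraph n
  H = record { adj = arcsOf ps ; loopless = λ x → to T-not-≡ (from T-not (no-loop x)) }
    where
    no-loop : ∀ x → ¬ T (arcsOf ps x x)
    no-loop x xx = let σ , σ∈ , x≡σx = arcsOf⁻ xx in fixed-point-free σ∈ x (sym x≡σx)

  regular : ArcDisjoint ps → Regular H (length ps)
  regular disjoint x = trans (count≡cnt (arcsOf ps x)) (deg⁺-arcsOf disjoint x) ,
                       trans (count≡cnt (λ z → arcsOf ps z x)) (deg⁻-arcsOf disjoint x)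

  module _ {σ₀ : Permutation′ n} {v₀ : Fin n} (σ₀∈ps : σ₀ ∈ ps)
           (spanning : Connectivity.Spanning σ₀ v₀ ps) where
    open Connectivity σ₀ v₀

    N⁺ N⁻ : BoolPred n → BoolPred n
    N⁺ S y = anyFin (λ x → S x ∧ arcsOf ps x y)
    N⁻ S y = anyFin (λ x → S x ∧ arcsOf ps y x)

    out-expands : (S : BoolPred n) {a b : Fin n} → T (S a) → ¬ T (S b) → cnt S < cnt (N⁺ S)
    out-expands S Sa ¬Sb with escape spanning S Sa ¬Sb
    ... | σ , x , σ∈ , Sx , ¬Sσ₀⁻¹σx = begin-strict
      cnt S                 ≡⟨ cnt-∘-permute (Permutation.flip σ₀) S ⟨
      cnt (S ∘ (σ₀ ⟨$⟩ˡ_))  <⟨ cnt-< σ₀-image (σ ⟨$⟩ʳ x) σx∈N⁺ ¬Sσ₀⁻¹σx ⟩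
      cnt (N⁺ S)            ∎
      where
      open ≤-Reasoning
      σ₀-image : S ∘ (σ₀ ⟨$⟩ˡ_) ⊆ᵇ N⁺ S
      σ₀-image y Sσ₀⁻¹y =
        anyFin⁺ _ (σ₀ ⟨$⟩ˡ y) (from T-∧ (Sσ₀⁻¹y , subst (T ∘ arcsOf ps _) (inverseʳ σ₀) (arcsOf⁺ σ₀∈ps _)))
      σx∈N⁺ : T (N⁺ S (σ ⟨$⟩ʳ x))
      σx∈N⁺ = anyFin⁺ _ x (from T-∧ (Sx , arcsOf⁺ σ∈ x))

    in-expands : (S : BoolPred n) {a b : Fin n} → T (S a) → ¬ T (S b) → cnt S < cnt (N⁻ S)
    in-expands S {a} {b} Sa ¬Sb with escape spanning (∁ S ∘ (σ₀ ⟨$⟩ʳ_)) {σ₀ ⟨$⟩ˡ b} {σ₀ ⟨$⟩ˡ a}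
                                    (from T-not (subst (¬_ ∘ T ∘ S) (sym (inverseʳ σ₀)) ¬Sb))
                                    (λ ¬Sa → to T-not ¬Sa (subst (T ∘ S) (sym (inverseʳ σ₀)) Sa))
    ... | σ , y , σ∈ , ¬Sσ₀y , ¬¬Sσy = begin-strict
      cnt S                 ≡⟨ cnt-∘-permute σ₀ S ⟨
      cnt (S ∘ (σ₀ ⟨$⟩ʳ_))  <⟨ cnt-< σ₀-preimage y y∈N⁻ (to T-not ¬Sσ₀y) ⟩
      cnt (N⁻ S)            ∎
      where
      open ≤-Reasoning
      σ₀-preimage : S ∘ (σ₀ ⟨$⟩ʳ_) ⊆ᵇ N⁻ S
      σ₀-preimage z Sσ₀z = anyFin⁺ _ (σ₀ ⟨$⟩ʳ z) (from T-∧ (Sσ₀z , arcsOf⁺ σ₀∈ps z))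
      y∈N⁻ : T (N⁻ S y)
      y∈N⁻ = anyFin⁺ _ (σ ⟨$⟩ʳ y) (from T-∧ (subst (T ∘ S) (inverseʳ σ₀) (¬T-not⇒T ¬¬Sσy) , arcsOf⁺ σ∈ y))

    expander : Expander H
    expander S (a , a∈S) (b , b∈∁S) =
      subst₂ _<_ (sym (∣∣≡cnt S)) (sym (∣tabulate∣≡cnt (N⁻ (lookup S)))) (in-expands (lookup S) Sa ¬Sb) ,
      subst₂ _<_ (sym (∣∣≡cnt S)) (sym (∣tabulate∣≡cnt (N⁺ (lookup S)))) (out-expands (lookup S) Sa ¬Sb)
      where
      Sa : T (lookup S a)
      Sa = ∈⇒T-lookup a∈S
      ¬Sb : ¬ T (lookup S b)
      ¬Sb = to T-not (subst T (lookup-map b not S) (∈⇒T-lookup b∈∁S))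

-- Packing permutations into G

module Construction {n} (G : Digraph n) {L D : ℕ} (G-dense : DegreeSum> (adj G) (n + L + 2 * D)) where

  record Packing (k : ℕ) : Set where
    field
      perms    : List (Permutation′ n)
      size     : length perms ≡ k
      in-G     : ∀ {σ} → σ ∈ perms → ∀ x → T (adj G x (σ ⟨$⟩ʳ x))
      disjoint : ArcDisjoint perms
  open Packing

  _⊑_ : ∀ {k k′} → Packing k → Packing k′ → Set
  P ⊑ P′ = ∀ {σ} → σ ∈ perms P → σ ∈ perms P′

  free : ∀ {k} → Packing k → BoolRel n
  free P = adj G ∖² arcsOf (perms P)

  free-dense : ∀ {k} (P : Packing k) → k ≤ D → DegreeSum> (free P) (n + L)
  free-dense P k≤D x y = +-cancelʳ-< (2 * D) (n + L) _ (begin-strict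
    n + L + 2 * D                                       <⟨ G-dense x y ⟩
    deg⁺ (adj G) x + deg⁻ (adj G) y                     ≤⟨ +-mono-≤ deg⁺-bound deg⁻-bound ⟩
    (deg⁺ (free P) x + D) + (deg⁻ (free P) y + D)       ≡⟨ rearrange (deg⁺ (free P) x) (deg⁻ (free P) y) D ⟩
    deg⁺ (free P) x + deg⁻ (free P) y + 2 * D           ∎)
    where
    open ≤-Reasoning
    rearrange : ∀ a b d → (a + d) + (b + d) ≡ a + b + 2 * d
    rearrange = solve-∀
    used≤D : ∀ {m} → m ≡ length (perms P) → m ≤ D
    used≤D refl = ≤-trans (≤-reflexive (size P)) k≤D
    deg⁺-bound : deg⁺ (adj G) x ≤ deg⁺ (free P) x + D
    deg⁺-bound = ≤-trans (cnt≤cnt-∖+cnt (adj G x) (arcsOf (perms P) x))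
                         (+-monoʳ-≤ (deg⁺ (free P) x) (used≤D (deg⁺-arcsOf (disjoint P) x)))
    deg⁻-bound : deg⁻ (adj G) y ≤ deg⁻ (free P) y + D
    deg⁻-bound = ≤-trans (cnt≤cnt-∖+cnt (λ z → adj G z y) (λ z → arcsOf (perms P) z y))
                         (+-monoʳ-≤ (deg⁻ (free P) y) (used≤D (deg⁻-arcsOf (disjoint P) y)))

  add : ∀ {k} (P : Packing k) (σ : Permutation′ n) → (∀ x → T (free P x (σ ⟨$⟩ʳ x))) → Packing (suc k)
  add P σ σ-free = record
    { perms    = σ ∷ perms P
    ; size     = cong suc (size P)
    ; in-G     = λ { (here refl) x → proj₁ (to T-∧ (σ-free x)) ; (there τ∈) x → in-G P τ∈ x }
    ; disjoint = All.tabulate (λ τ∈ x σx≡τx → σ-avoids τ∈ x σx≡τx) ∷ disjoint P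
    }
    where
    σ-avoids : ∀ {τ} → τ ∈ perms P → ∀ x → σ ⟨$⟩ʳ x ≢ τ ⟨$⟩ʳ x
    σ-avoids τ∈ x σx≡τx =
      to T-not (proj₂ (to T-∧ (σ-free x))) (subst (T ∘ arcsOf (perms P) x) (sym σx≡τx) (arcsOf⁺ τ∈ x))

  cover-step : ∀ {k} (P : Packing k) → k < D → (M : BoolRel n) → IsPartialMatching (adj G) M → cnt (dom M) ≤ L →
    Σ (Packing (suc k)) λ P′ → P ⊑ P′ × M ⊆² arcsOf (perms P′)
  cover-step P k<D M M-matching dom≤L =
    let τ , τ-free , τ-ext = PerfectMatching.perfectMatching-extending
                               (∖²-isPartialMatching (arcsOf (perms P)) M-matching)
                               (≤-trans (cnt-mono (dom-∖² M (arcsOf (perms P)))) dom≤L) (free-dense P (<⇒≤ k<D))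
    in add P τ τ-free , there , covered {τ} τ-ext
    where
    covered : ∀ {τ} → Extends τ (M ∖² arcsOf (perms P)) → M ⊆² arcsOf (τ ∷ perms P)
    covered {τ} τ-ext x y Mxy with T? (arcsOf (perms P) x y)
    ... | yes old = arcsOf-mono {ps = perms P} {ps′ = τ ∷ perms P} there x y old
    ... | no  new = subst (T ∘ arcsOf (τ ∷ perms P) x) (τ-ext (from T-∧ (Mxy , from T-not new)))
                          (arcsOf⁺ {ps = τ ∷ perms P} (here refl) x)

  cover-all : ∀ {k} (P : Packing k) (Ms : List (BoolRel n)) → length Ms + k ≤ D →
    (∀ {M} → M ∈ Ms → IsPartialMatching (adj G) M × cnt (dom M) ≤ L) →
    Σ (Packing (length Ms + k)) λ P′ → P ⊑ P′ × ∀ {M} → M ∈ Ms → M ⊆² arcsOf (perms P′)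
  cover-all P []       _     _     = P , id , λ ()
  cover-all P (M ∷ Ms) bound Ms-ok =
    let P₁ , P⊑P₁ , P₁-covers   = cover-all P Ms (≤-trans (n≤1+n _) bound) (Ms-ok ∘ there)
        M-matching , M-dom≤L    = Ms-ok (here refl)
        P₂ , P₁⊑P₂ , P₂-covers-M = cover-step P₁ bound M M-matching M-dom≤L
    in P₂ , P₁⊑P₂ ∘ P⊑P₁ , λ { (here refl) x y Mxy → P₂-covers-M x y Mxy
                             ; (there M′∈) x y M′xy → arcsOf-mono {ps = perms P₁} P₁⊑P₂ x y (P₁-covers M′∈ x y M′xy) }

  module Rounds (σ₀ : Permutation′ n) (v₀ : Fin n) where
    open Connectivity σ₀ v₀

    Progress : ∀ {k} → Packing k → BoolPred n → ℕ → ℕ → Set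
    Progress P C k′ m = Σ (Packing k′) λ P′ → P ⊑ P′ × Σ (BoolPred n) λ C′ → Reaches (perms P′) C′ × C ⊆ᵇ C′ × Grown C C′ m

    round : ∀ {k} (P : Packing k) → k < D → (C : BoolPred n) → 1 ≤ cnt C → Reaches (perms P) C → Progress P C (suc k) L
    round {k} P k<D C C-nonempty C-reached =
      let k′ , k′≤L , g , grown = greedy
          τ , τ-free , τ-ext    = PerfectMatching.perfectMatching-extending (Stage.matching g)
                                    (≤-trans (Stage.dom-size g) k′≤L) R-dense
      in add P (τ ∘ₚ σ₀) τ-free , there , Stage.reached g , reaches g {τ} τ-ext , Stage.C₀⊆reached g , grown
      where
      R-dense : DegreeSum> (twist (free P) σ₀) (n + L)
      R-dense = twist-dense σ₀ (free-dense P (<⇒≤ k<D))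
      open Growth R-dense C C-nonempty using (Stage; greedy; module Stage)
      reaches : ∀ {k′} (g : Stage k′) {τ} → Extends τ (Stage.arcs g) → Reaches (τ ∘ₚ σ₀ ∷ perms P) (Stage.reached g)
      reaches g {τ} τ-ext S closed Sv₀ y y∈ =
        Reachable⇒∈ S arcs-closed (C-reached S (Closed-anti there closed) Sv₀) (Stage.reachable g y∈)
        where
        arcs-closed : ∀ a b → T (Stage.arcs g a b) → T (S a) → T (S b)
        arcs-closed a b ab Sa = subst (T ∘ S) (trans (inverseˡ σ₀) (τ-ext ab)) (closed (here refl) a Sa)

    rounds : ∀ {k} (r : ℕ) (P : Packing k) → r + k ≤ D → (C : BoolPred n) → 1 ≤ cnt C → Reaches (perms P) C →
      Progress P C (r + k) (r * L)
    rounds zero    P _     C _          C-reached = P , id , C , C-reached , (λ _ Cx → Cx) , inj₂ (≤-reflexive (+-identityʳ _))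
    rounds (suc r) P bound C C-nonempty C-reached =
      let P₁ , P⊑P₁ , C₁ , C₁-reached , C⊆C₁ , grown₁ = rounds r P (≤-trans (n≤1+n _) bound) C C-nonempty C-reached
          P₂ , P₁⊑P₂ , C₂ , C₂-reached , C₁⊆C₂ , grown₂ = round P₁ bound C₁ (≤-trans C-nonempty (cnt-mono C⊆C₁)) C₁-reached
      in P₂ , P₁⊑P₂ ∘ P⊑P₁ , C₂ , C₂-reached , (λ x → C₁⊆C₂ x ∘ C⊆C₁ x) , Grown-trans C₁⊆C₂ grown₁ grown₂

    spanning : ∀ {k} (c : ℕ) → n < c * L → (P : Packing k) → c + k ≤ D →
      Σ (Packing (c + k)) λ P′ → P ⊑ P′ × Spanning (perms P′)
    spanning c n<cL P bound =
      let P′ , P⊑P′ , C , C-reached , _ , grown = rounds c P bound ｛ v₀ ｝ (≤-reflexive (sym (cnt-｛｝ v₀))) v₀-reaches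
      in P′ , P⊑P′ , λ S closed Sv₀ y _ → C-reached S closed Sv₀ y (cnt≡n⇒∀ C (full grown) y)
      where
      v₀-reaches : Reaches (perms P) ｛ v₀ ｝
      v₀-reaches S _ Sv₀ y y≡v₀ = subst (T ∘ S) (sym (∈｛｝⇒≡ y≡v₀)) Sv₀
      full : ∀ {C} → Grown ｛ v₀ ｝ C (c * L) → cnt C ≡ n
      full (inj₁ C-full) = C-full
      full {C} (inj₂ C-big) =
        ⊥-elim (<-irrefl refl (<-≤-trans n<cL (≤-trans (m≤n+m (c * L) (cnt ｛ v₀ ｝)) (≤-trans C-big (cnt≤n C)))))

  empty : Packing 0
  empty = record { perms = [] ; size = refl ; in-G = λ () ; disjoint = [] }

  first : Σ (Packing 1) λ P → ∃ λ σ₀ → σ₀ ∈ perms P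
  first = let σ₀ , σ₀-free , _ = PerfectMatching.perfectMatching-extending ∅²-isPartialMatching
                                    (≤-trans (cnt-dom-∅² {n}) z≤n) (free-dense empty z≤n)
          in add empty σ₀ σ₀-free , σ₀ , here refl

  derangement : ∀ {k} (P : Packing k) {σ} → σ ∈ perms P → ∀ x → σ ⟨$⟩ʳ x ≢ x
  derangement P σ∈ x σx≡x = subst T (trans (cong (adj G x) σx≡x) (loopless G x)) (in-G P σ∈ x)

  digraph : ∀ {k} → Packing k → Digraph n
  digraph P = Union.H (perms P) (derangement P)

  digraph-⊆ : ∀ {k} (P : Packing k) → digraph P ⊆ᴰ G
  digraph-⊆ P x y xy with arcsOf⁻ {ps = perms P} xy
  ... | σ , σ∈ , refl = in-G P σ∈ x

  digraph-regular : ∀ {k} (P : Packing k) → Regular (digraph P) k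
  digraph-regular {k} P = subst (Regular (digraph P)) (size P) (Union.regular (perms P) (derangement P) (disjoint P))

  regular-expander : (v₀ : Fin n) (c : ℕ) → n < c * L → (Ms : List (BoolRel n)) →
    (∀ {M} → M ∈ Ms → IsPartialMatching (adj G) M × cnt (dom M) ≤ L) → c + (length Ms + 1) ≤ D →
    Σ (Digraph n) λ H → H ⊆ᴰ G × Regular H (c + (length Ms + 1)) × (∀ {M} → M ∈ Ms → M ⊆² adj H) × Expander H
  regular-expander v₀ c n<cL Ms Ms-ok enough =
    let P₁ , σ₀ , σ₀∈P₁          = first
        P₂ , P₁⊑P₂ , P₂-covers   = cover-all P₁ Ms (≤-trans (m≤n+m _ c) enough) Ms-ok
        P₃ , P₂⊑P₃ , P₃-spanning = Rounds.spanning σ₀ v₀ c n<cL P₂ enough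
    in digraph P₃ , digraph-⊆ P₃ , digraph-regular P₃ ,
       (λ M∈ x y Mxy → arcsOf-mono {ps = perms P₂} P₂⊑P₃ x y (P₂-covers M∈ x y Mxy)) ,
       Union.expander (perms P₃) (derangement P₃) (P₂⊑P₃ (P₁⊑P₂ σ₀∈P₁)) P₃-spanning

-- Splitting F into partial matchings

rank : BoolPred n → Fin n → ℕ
rank P a = cnt (λ z → P z ∧ (toℕ z <ᵇ toℕ a))

module _ {n} {P : BoolPred n} where

  private
    a≮a : ∀ a → ¬ T (P a ∧ (toℕ a <ᵇ toℕ a))
    a≮a a Pa∧a<a = <-irrefl refl (<ᵇ⇒< (toℕ a) (toℕ a) (proj₂ (to (T-∧ {P a}) Pa∧a<a)))

  rank<cnt : ∀ {a} → T (P a) → rank P a < cnt P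
  rank<cnt {a} Pa = cnt-< (λ z Pz∧z<a → proj₁ (to (T-∧ {P z}) Pz∧z<a)) a Pa (a≮a a)

  rank-mono : ∀ {a b} → T (P a) → toℕ a < toℕ b → rank P a < rank P b
  rank-mono {a} {b} Pa a<b = cnt-< below-a⊆below-b a (from T-∧ (Pa , <⇒<ᵇ a<b)) (a≮a a)
    where
    below-a⊆below-b : (λ z → P z ∧ (toℕ z <ᵇ toℕ a)) ⊆ᵇ (λ z → P z ∧ (toℕ z <ᵇ toℕ b))
    below-a⊆below-b z Pz∧z<a = let Pz , z<a = to (T-∧ {P z}) Pz∧z<a in
      from T-∧ (Pz , <⇒<ᵇ (<-trans (<ᵇ⇒< (toℕ z) (toℕ a) z<a) a<b))

  rank-injective : ∀ {a b} → T (P a) → T (P b) → rank P a ≡ rank P b → a ≡ b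
  rank-injective {a} {b} Pa Pb same with <-cmp (toℕ a) (toℕ b)
  ... | tri< a<b _ _ = ⊥-elim (<-irrefl same (rank-mono Pa a<b))
  ... | tri≈ _ a≡b _ = toℕ-injective a≡b
  ... | tri> _ _ b<a = ⊥-elim (<-irrefl (sym same) (rank-mono Pb b<a))

cnt-below : ∀ n m → cnt {n} (λ x → toℕ x <ᵇ m) ≤ m
cnt-below zero    m       = z≤n
cnt-below (suc n) zero    = ≤-reflexive (cnt-false {n})
cnt-below (suc n) (suc m) = s≤s (cnt-below n m)

-- Stated with _<ᵇ_, which (unlike ⌊ _<?_ ⌋) reduces on suc/suc, so the count unfolds by computation.
cnt-interval : ∀ n lo L → cnt {n} (λ x → not (toℕ x <ᵇ lo) ∧ (toℕ x <ᵇ lo + L)) ≤ L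
cnt-interval n       zero     L = cnt-below n L
cnt-interval zero    (suc lo) L = z≤n
cnt-interval (suc n) (suc lo) L = cnt-interval n lo L

classIndices : ℕ → ℕ → List (ℕ × ℕ × ℕ)
classIndices f c = cartesianProduct (upTo f) (cartesianProduct (upTo f) (upTo c))

module Classes {n} (F : Digraph n) (L : ℕ) .{{_ : NonZero L}} where

  outRank inRank : Fin n → Fin n → ℕ
  outRank x y = rank (adj F x) y
  inRank  x y = rank (λ z → adj F z y) x

  inBlock : ℕ → BoolPred n
  inBlock b x = not (toℕ x <ᵇ b * L) ∧ (toℕ x <ᵇ b * L + L)

  class : ℕ × ℕ × ℕ → BoolRel n
  class (i , j , b) x y = adj F x y ∧ ((outRank x y ≡ᵇ i) ∧ ((inRank x y ≡ᵇ j) ∧ inBlock b x))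

  class⁻ : ∀ i j b {x y} → T (class (i , j , b) x y) →
    T (adj F x y) × outRank x y ≡ i × inRank x y ≡ j × T (inBlock b x)
  class⁻ i j b {x} {y} xy =
    let Fxy , ranks-block = to (T-∧ {adj F x y}) xy
        out≡i , in-block  = to (T-∧ {outRank x y ≡ᵇ i}) ranks-block
        in≡j , block      = to (T-∧ {inRank x y ≡ᵇ j}) in-block
    in Fxy , ≡ᵇ⇒≡ _ _ out≡i , ≡ᵇ⇒≡ _ _ in≡j , block

  class-isPartialMatching : ∀ t → IsPartialMatching (adj F) (class t)
  class-isPartialMatching (i , j , b) = record
    { ⊆E         = λ x y xy → proj₁ (class⁻ i j b xy)
    ; functional = λ xy xy′ → let Fxy , out≡i , _ = class⁻ i j b xy ; Fxy′ , out′≡i , _ = class⁻ i j b xy′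
                              in rank-injective Fxy Fxy′ (trans out≡i (sym out′≡i))
    ; injective  = λ xy x′y → let Fxy , _ , in≡j , _ = class⁻ i j b xy ; Fx′y , _ , in′≡j , _ = class⁻ i j b x′y
                              in rank-injective Fxy Fx′y (trans in≡j (sym in′≡j))
    }

  cnt-dom-class : ∀ t → cnt (dom (class t)) ≤ L
  cnt-dom-class (i , j , b) = ≤-trans (cnt-mono dom⊆block) (cnt-interval n (b * L) L)
    where
    dom⊆block : dom (class (i , j , b)) ⊆ᵇ inBlock b
    dom⊆block x x∈dom = let _ , xy = anyFin⁻ (class (i , j , b) x) x∈dom in proj₂ (proj₂ (proj₂ (class⁻ i j b xy)))

  in-own-block : ∀ x → T (inBlock (toℕ x / L) x)
  in-own-block x = from T-∧ (from T-not (λ x<lo → <⇒≱ (<ᵇ⇒< (toℕ x) (toℕ x / L * L) x<lo) (m/n*n≤m (toℕ x) L)) , <⇒<ᵇ x<hi)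
    where
    x<hi : toℕ x < toℕ x / L * L + L
    x<hi = begin-strict
      toℕ x                       ≡⟨ m≡m%n+[m/n]*n (toℕ x) L ⟩
      toℕ x % L + toℕ x / L * L   <⟨ +-monoˡ-< (toℕ x / L * L) (m%n<n (toℕ x) L) ⟩
      L + toℕ x / L * L           ≡⟨ +-comm L _ ⟩
      toℕ x / L * L + L           ∎
      where open ≤-Reasoning

  class-of : ∀ {f c} → MaxSemiDeg≤ F f → n < c * L → ∀ {x y} → T (adj F x y) →
    ∃ λ t → t ∈ classIndices f c × T (class t x y)
  class-of {f} {c} Δ⁰F≤f n<cL {x} {y} Fxy =
    (outRank x y , inRank x y , toℕ x / L) ,
    ∈-cartesianProduct⁺ (∈-upTo⁺ out<f) (∈-cartesianProduct⁺ (∈-upTo⁺ in<f) (∈-upTo⁺ block<c)) ,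
    from (T-∧ {adj F x y}) (Fxy , from (T-∧ {outRank x y ≡ᵇ outRank x y})
      (≡⇒≡ᵇ (outRank x y) _ refl , from (T-∧ {inRank x y ≡ᵇ inRank x y}) (≡⇒≡ᵇ (inRank x y) _ refl , in-own-block x)))
    where
    out<f : outRank x y < f
    out<f = <-≤-trans (rank<cnt {P = adj F x} Fxy) (subst (_≤ f) (count≡cnt (adj F x)) (proj₁ (Δ⁰F≤f x)))
    in<f : inRank x y < f
    in<f = <-≤-trans (rank<cnt {P = λ z → adj F z y} Fxy) (subst (_≤ f) (count≡cnt (λ z → adj F z y)) (proj₂ (Δ⁰F≤f y)))
    block<c : toℕ x / L < c
    block<c = m<n*o⇒m/o<n (<-trans (toℕ<n x) n<cL)

-- The hypotheses (q + 2p)n ≤ 2q·a, 2q·b say that a, b ≥ (1/2 + α)n for α = p/q.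
semidegree-sum : ∀ n p q L D {a b} → 1 ≤ p → q * L ≤ n + q → 2 * q * D + q < n →
  (q + 2 * p) * n ≤ 2 * q * a → (q + 2 * p) * n ≤ 2 * q * b → n + L + 2 * D < a + b
semidegree-sum n p q L D {a} {b} 1≤p qL≤n+q 2qD+q<n δa δb =
  *-cancelˡ-< q (n + L + 2 * D) (a + b) (begin-strict
    q * (n + L + 2 * D)            ≡⟨ expand q n L D ⟩
    q * n + (q * L + 2 * q * D)    ≤⟨ +-monoʳ-≤ (q * n) (+-monoˡ-≤ (2 * q * D) qL≤n+q) ⟩
    q * n + (n + q + 2 * q * D)    ≡⟨ cong (q * n +_) (regroup n q (2 * q * D)) ⟩
    q * n + (n + (2 * q * D + q))  <⟨ +-monoʳ-< (q * n) (+-monoʳ-< n 2qD+q<n) ⟩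
    q * n + (n + n)                ≡⟨ collect q n ⟩
    (q + 2 * 1) * n                ≤⟨ *-monoˡ-≤ n (+-monoʳ-≤ q (*-monoʳ-≤ 2 1≤p)) ⟩
    (q + 2 * p) * n                ≤⟨ *-cancelˡ-≤ 2 (begin
      2 * ((q + 2 * p) * n)            ≡⟨ double ((q + 2 * p) * n) ⟩
      (q + 2 * p) * n + (q + 2 * p) * n ≤⟨ +-mono-≤ δa δb ⟩
      2 * q * a + 2 * q * b            ≡⟨ factor q a b ⟩
      2 * (q * (a + b))                ∎) ⟩
    q * (a + b)                    ∎)
  where
  open ≤-Reasoning
  expand : ∀ x y z w → x * (y + z + 2 * w) ≡ x * y + (x * z + 2 * x * w)
  expand = solve-∀
  regroup : ∀ x y z → x + y + z ≡ x + (z + y)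
  regroup = solve-∀
  collect : ∀ x y → x * y + (y + y) ≡ (x + 2 * 1) * y
  collect = solve-∀
  double : ∀ x → 2 * x ≡ x + x
  double = solve-∀
  factor : ∀ x y z → 2 * x * y + 2 * x * z ≡ 2 * (x * (y + z))
  factor = solve-∀

cube≤ : ∀ m n q → 1 ≤ q → m ^ 2 ≤ n → m ^ 3 ≤ 25 ^ 3 * n ^ 2 * q ^ 3
cube≤ zero        _ _           _ _    = z≤n
cube≤ m@(suc _)   n q@(suc _)   _ m²≤n = begin
  m ^ 3                    ≤⟨ m≤m*n (m ^ 3) m ⟩
  m ^ 3 * m                ≡⟨ *-comm (m ^ 3) m ⟩
  m ^ 4                    ≡⟨ ^-distribˡ-+-* m 2 2 ⟩
  m ^ 2 * m ^ 2            ≤⟨ *-mono-≤ m²≤n m²≤n ⟩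
  n * n                    ≡⟨ cong (n *_) (*-identityʳ n) ⟨
  n ^ 2                    ≤⟨ m≤n*m (n ^ 2) (25 ^ 3) ⟩
  25 ^ 3 * n ^ 2           ≤⟨ m≤m*n (25 ^ 3 * n ^ 2) (q ^ 3) ⟩
  25 ^ 3 * n ^ 2 * q ^ 3   ∎
  where open ≤-Reasoning

q*[1+n/q]≤n+q : ∀ n q .{{_ : NonZero q}} → q * suc (n / q) ≤ n + q
q*[1+n/q]≤n+q n q = begin
  q * suc (n / q)     ≡⟨ *-suc q (n / q) ⟩
  q + q * (n / q)     ≡⟨ cong (q +_) (*-comm q (n / q)) ⟩
  q + n / q * q       ≤⟨ +-monoʳ-≤ q (m/n*n≤m n q) ⟩
  q + n               ≡⟨ +-comm q n ⟩
  n + q               ∎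
  where open ≤-Reasoning

n<q*[1+n/q] : ∀ n q .{{_ : NonZero q}} → n < q * suc (n / q)
n<q*[1+n/q] n q = begin-strict
  n                   ≡⟨ m≡m%n+[m/n]*n n q ⟩
  n % q + n / q * q   <⟨ +-monoˡ-< (n / q * q) (m%n<n n q) ⟩
  q + n / q * q       ≡⟨ cong (q +_) (*-comm (n / q) q) ⟩
  q + q * (n / q)     ≡⟨ *-suc q (n / q) ⟨
  q * suc (n / q)     ∎
  where open ≤-Reasoning

regular-expander-containing : ∀ {n} (G F : Digraph n) (f c L : ℕ) .{{_ : NonZero L}} → 0 < n → n < c * L →
  DegreeSum> (adj G) (n + L + 2 * (c + (length (classIndices f c) + 1))) → F ⊆ᴰ G → MaxSemiDeg≤ F f →
  Σ (Digraph n) λ H → H ⊆ᴰ G × Regular H (c + (length (classIndices f c) + 1)) × F ⊆ᴰ H × Expander H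
regular-expander-containing {n} G F f c L 0<n n<cL G-dense F⊆G Δ⁰F≤f =
  let H , H⊆G , H-regular , Ms⊆H , H-expander =
        Construction.regular-expander G G-dense (fromℕ< 0<n) c n<cL Ms Ms-ok (≤-reflexive (cong size |Ms|≡))
  in H , H⊆G , subst (Regular H) (cong size |Ms|≡) H-regular , F⊆H {H} Ms⊆H , H-expander
  where
  open Classes F L
  size : ℕ → ℕ
  size m = c + (m + 1)
  Ms : List (BoolRel n)
  Ms = map class (classIndices f c)
  |Ms|≡ : length Ms ≡ length (classIndices f c)
  |Ms|≡ = length-map class (classIndices f c)
  Ms-ok : ∀ {M} → M ∈ Ms → IsPartialMatching (adj G) M × cnt (dom M) ≤ L
  Ms-ok M∈ with ∈-map⁻ class M∈
  ... | t , _ , refl = isPartialMatching-⊆ F⊆G (class-isPartialMatching t) , cnt-dom-class t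
  F⊆H : ∀ {H} → (∀ {M} → M ∈ Ms → M ⊆² adj H) → F ⊆ᴰ H
  F⊆H Ms⊆H x y Fxy = let t , t∈ , xy = class-of Δ⁰F≤f n<cL Fxy in Ms⊆H (∈-map⁺ class t∈) x y xy

lemma2p20 : (f p q : ℕ) → 0 < p → 0 < q →
    Σ ℕ λ n₀ → (n : ℕ) → n₀ ≤ n →
    (G F : Digraph n) →
    (∀ x → ((q + 2 * p) * n ≤ 2 * q * outdeg G x) × ((q + 2 * p) * n ≤ 2 * q * indeg G x)) →
    F ⊆ᴰ G → MaxSemiDeg≤ F f →
    Σ ℕ λ d → Σ (Digraph n) λ H →
      H ⊆ᴰ G × Regular H d × F ⊆ᴰ H ×
      ((d * p) ^ 3 ≤ (25 ^ 3) * (n ^ 2) * (q ^ 3)) × Expander H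
lemma2p20 f p q@(suc _) 1≤p _ = n₀ , λ n n₀≤n G F δ⁰G F⊆G Δ⁰F≤f →
  let L = suc (n / q)
      G-dense : DegreeSum> (adj G) (n + L + 2 * D)
      G-dense x y = semidegree-sum n p q L D 1≤p (q*[1+n/q]≤n+q n q) (≤-trans (m≤m+n _ _) n₀≤n)
                      (subst (λ d → (q + 2 * p) * n ≤ 2 * q * d) (count≡cnt (adj G x)) (proj₁ (δ⁰G x)))
                      (subst (λ d → (q + 2 * p) * n ≤ 2 * q * d) (count≡cnt (λ z → adj G z y)) (proj₂ (δ⁰G y)))
      H , H⊆G , H-regular , F⊆H , H-expander =
        regular-expander-containing G F f q L (≤-trans (s≤s z≤n) n₀≤n) (n<q*[1+n/q] n q) G-dense F⊆G Δ⁰F≤f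
  in D , H , H⊆G , H-regular , F⊆H , cube≤ (D * p) n q (s≤s z≤n) (≤-trans (m≤n+m _ _) n₀≤n) , H-expander
  where
  -- D counts σ₀, one permutation per class of F and q connecting rounds.
  D n₀ : ℕ
  D  = q + (length (classIndices f q) + 1)
  n₀ = suc (2 * q * D + q) + (D * p) ^ 2
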